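{- For every $\delta>0$ and $n\in\mathbb{N}$ there exists $N\in\mathbb{N}$ such that the following holds for every $N$-partitioned hypergraph $H$ and every choice of subsets $C_{ijk}\subseteq V_{ik}$, $i<j<k$, $i,j,k\in[N]$, with $|C_{ijk}|\ge\delta|V_{ik}|$. There exist an induced $n$-partitioned subhypergraph of $H$ with index set $I\subseteq[N]$ and vertices $\gamma_{ik}$, $i<k$, $i,k\in I$, such that $\gamma_{ik}\in C_{ijk}$ for all $j\in I$ with $i<j<k$.
   Context: An $N$-partitioned hypergraph $H$ is a $3$-uniform hypergraph whose vertex set is partitioned into nonempty finite sets $V_{ij}$, $1\le i<j\le N$, such that every edge has one vertex in each of $V_{ij},V_{ik},V_{jk}$ for some $1\le i<j<k\le N$. For $I\subseteq[N]$, the subhypergraph induced by $I$ is the $|I|$-partitioned hypergraph with parts $V_{ij}$, $i<j$, $i,j\in I$ (keeping original indices) and all edges of $H$ contained in the union of these parts; $I$ is its index set.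
   Formalization: The density parameter δ ranges over the positive rationals. -}

module Defs where

open import Level using (0ℓ)
open import Data.Nat as ℕ using (ℕ; _≤_)
open import Data.Integer using (+_)
open import Data.Fin using (Fin; _<_)
open import Data.Fin.Subset using (Subset; _∈_; ∣_∣)
open import Data.Rational as ℚ using (ℚ; _/_)
open import Relation.Binary.PropositionalEquality using (_≡_)

ℕ→ℚ : ℕ → ℚ
ℕ→ℚ m = + m / 1

-- Edges: for i < j < k, a predicate on triples (x,y,z) ∈ V_ij × V_ik × V_jk;
-- every edge has exactly one vertex in each of V_ij, V_ik, V_jk.
record PartitionedHypergraph (N : ℕ) : Set₁ where
  field
    size     : (i j : Fin N) → ℕ
    nonempty : (i j : Fin N) → i < j → 1 ≤ size i j
    edge     : (i j k : Fin N) → i < j → j < k →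
               Fin (size i j) → Fin (size i k) → Fin (size j k) → Set

V : ∀ {N} → PartitionedHypergraph N → Fin N → Fin N → Set
V H i j = Fin (PartitionedHypergraph.size H i j)

-- An induced n-partitioned subhypergraph of H is determined by its index
-- set I ⊆ [N] with |I| = n (parts V_ij, i<j in I, and all edges of H
-- contained in their union); we record it by its index set.
record InducedSub {N : ℕ} (H : PartitionedHypergraph N) (n : ℕ) : Set where
  field
    I    : Subset N
    card : ∣ I ∣ ≡ n

{-# OPTIONS --safe #-}
module Submission where

-- Write D for the denominator of δ, so that every candidate set C_ijk contains at least a 1/D
-- fraction of V_ik.  Fix i and a list of indices above it, and let k be the largest of them.
-- Counting pairs (j, x) with x ∈ C_ijk shows that some x ∈ V_ik lies in C_ijk for at least a
-- 1/D fraction of the indices j below k; keep only those j and recurse.  From D·h + 1 indices this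
-- yields h indices, each k carrying a witness x_ik that serves every retained j < k.  Applying this
-- to the indices above the smallest index i and recursing on what is kept gives the index set I,
-- with γ_ik the witness found while i was the smallest remaining index.

open import Defs
open import Data.Bool.Base using (if_then_else_)
open import Data.Empty using (⊥-elim)
open import Data.Fin.Base using (Fin; zero; suc; _<_; _>_)
open import Data.Fin.Properties using (_<?_; <-irrefl; <-asym; <-irrelevant; <⇒≢)
open import Data.Fin.Subset using (Subset; _∈_; _∉_; ∣_∣; ⊤; ⁅_⁆; _∪_; ⋃; inside; outside)
open import Data.Fin.Subset.Properties
  using (_∈?_; ∈⊤; ∉⊥; ∣⊤∣≡n; ∣⊥∣≡0; ∪-identityˡ; drop-not-there; x∈p∪q⁻; x∈⁅y⁆⇒x≡y)
open import Data.Integer.Base as ℤ using (+_; +[1+_]; +0; -[1+_])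
import Data.Integer.Properties as ℤ
open import Data.List.Base using (List; []; _∷_; length; filter; map; reverse; allFin)
open import Data.List.Properties using (length-reverse; length-tabulate; unfold-reverse)
open import Data.List.Membership.Propositional using () renaming (_∈_ to _∈ₗ_)
open import Data.List.Relation.Binary.Subset.Propositional using (_⊆_)
open import Data.List.Relation.Binary.Subset.Propositional.Properties using (filter-⊆; ∷⁺ʳ)
open import Data.List.Relation.Unary.All as All using (All; []; _∷_)
open import Data.List.Relation.Unary.All.Properties using (anti-mono; all-filter)
open import Data.List.Relation.Unary.AllPairs as AllPairs using (AllPairs; []; _∷_)
import Data.List.Relation.Unary.AllPairs.Properties as AllPairs
open import Data.List.Relation.Unary.Any using (here; there)
import Data.List.Relation.Unary.Any.Properties as Any
open import Data.List.Relation.Unary.Unique.Propositional using (Unique)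
open import Data.Nat.Base as ℕ using (ℕ; zero; suc; _+_; z≤n; s≤s; NonZero)
open import Data.Nat.Properties
  using (≤-refl; ≤-trans; ≤-reflexive; _≤?_; ≰⇒≥; +-mono-≤; +-monoˡ-≤; +-cancelˡ-≤; +-cancelʳ-≤;
         *-suc; *-zeroʳ; *-comm; *-identityʳ; +-*-semiring; *-distribˡ-+; *-cancelˡ-≤; m≤n*m; module ≤-Reasoning)
open import Algebra.Properties.Semiring.Sum +-*-semiring using (sum; sum-cong-≗; ∑-distrib-+; *-distribˡ-sum)
open import Data.Product.Base as Product using (Σ; ∃; _×_; _,_; proj₁; proj₂)
open import Data.Rational using (ℚ; 0ℚ; _*_; _≤_; mkℚ; toℚᵘ; positive; ↧ₙ_) renaming (_<_ to _<ℚ_)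
open import Data.Rational.Properties using (toℚᵘ-mono-≤; toℚᵘ-homo-*; toℚᵘ-fromℚᵘ)
import Data.Rational.Unnormalised as ℚᵘ
import Data.Rational.Unnormalised.Properties as ℚᵘ
open import Data.Sum.Base using (inj₁; inj₂)
open import Data.Vec.Base using ([]; _∷_; here)
open import Function.Base using (_∘_; id; flip)
open import Relation.Nullary.Decidable.Core using (does; yes; no)
open import Relation.Nullary.Negation using (¬_)
open import Relation.Binary.PropositionalEquality
  using (_≡_; refl; cong; sym; trans; subst; subst₂; module ≡-Reasoning)

AllPairs-reverse⁺ : ∀ {a r} {A : Set a} {R : A → A → Set r} {xs} →
                    AllPairs R xs → AllPairs (flip R) (reverse xs)
AllPairs-reverse⁺ {xs = []}             []         = []
AllPairs-reverse⁺ {R = R} {xs = x ∷ xs} (Rx ∷ Rxs) =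
  subst (AllPairs (flip R)) (sym (unfold-reverse x xs))
    (AllPairs.++⁺ (AllPairs-reverse⁺ Rxs) ([] ∷ []) (All.map (_∷ []) (anti-mono Any.reverse⁻ Rx)))

indicator : ∀ {s} → Subset s → Fin s → ℕ
indicator p x = if does (x ∈? p) then 1 else 0

∑-indicator : ∀ {s} (p : Subset s) → sum (indicator p) ≡ ∣ p ∣
∑-indicator []            = refl
∑-indicator (inside  ∷ p) = cong suc (∑-indicator p)
∑-indicator (outside ∷ p) = ∑-indicator p

averaging : ∀ {s m} (f : Fin s → ℕ) → 0 ℕ.< s → s ℕ.* m ℕ.≤ sum f → ∃ λ x → m ℕ.≤ f x
averaging {suc s} f _ = go s f
  where
  go : ∀ s {m} (f : Fin (suc s) → ℕ) → suc s ℕ.* m ℕ.≤ sum f → ∃ λ x → m ℕ.≤ f x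
  go zero    {m} f sm≤ = zero , +-cancelʳ-≤ 0 m (f zero) sm≤
  go (suc s) {m} f sm≤ with m ≤? f zero
  ... | yes m≤f0 = zero , m≤f0
  ... | no  m≰f0 = Product.map suc id (go s (f ∘ suc) sm≤∑tail)
    where
    sm≤∑tail : suc s ℕ.* m ℕ.≤ sum (f ∘ suc)
    sm≤∑tail = +-cancelˡ-≤ (f zero) _ _ (≤-trans (+-monoˡ-≤ _ (≰⇒≥ m≰f0)) sm≤)

module _ {ℓ} {J : Set ℓ} {s : ℕ} (R : J → Subset s) where

  hits : Fin s → List J → ℕ
  hits x T = length (filter (λ j → x ∈? R j) T)

  hits-∷ : ∀ x j T → hits x (j ∷ T) ≡ indicator (R j) x + hits x T
  hits-∷ x j T with x ∈? R j
  ... | yes _ = refl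
  ... | no  _ = refl

  ∑-hits-∷ : ∀ j T → ∣ R j ∣ + sum (λ x → hits x T) ≡ sum (λ x → hits x (j ∷ T))
  ∑-hits-∷ j T = begin
    ∣ R j ∣ + sum (λ x → hits x T)                 ≡⟨ cong (_+ _) (∑-indicator (R j)) ⟨
    sum (indicator (R j)) + sum (λ x → hits x T)   ≡⟨ ∑-distrib-+ (indicator (R j)) (λ x → hits x T) ⟨
    sum (λ x → indicator (R j) x + hits x T)       ≡⟨ sum-cong-≗ (λ x → hits-∷ x j T) ⟨
    sum (λ x → hits x (j ∷ T))                     ∎
    where open ≡-Reasoning

  ∑-hits-≥ : ∀ D (T : List J) → (∀ j → s ℕ.≤ D ℕ.* ∣ R j ∣) →
             s ℕ.* length T ℕ.≤ D ℕ.* sum (λ x → hits x T)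
  ∑-hits-≥ D []      _     = ≤-trans (≤-reflexive (*-zeroʳ s)) z≤n
  ∑-hits-≥ D (j ∷ T) dense = begin
    s ℕ.* suc (length T)                           ≡⟨ *-suc s (length T) ⟩
    s + s ℕ.* length T                             ≤⟨ +-mono-≤ (dense j) (∑-hits-≥ D T dense) ⟩
    D ℕ.* ∣ R j ∣ + D ℕ.* sum (λ x → hits x T)     ≡⟨ *-distribˡ-+ D _ _ ⟨
    D ℕ.* (∣ R j ∣ + sum (λ x → hits x T))         ≡⟨ cong (D ℕ.*_) (∑-hits-∷ j T) ⟩
    D ℕ.* sum (λ x → hits x (j ∷ T))               ∎
    where open ≤-Reasoning

  popular-point : ∀ D (T : List J) → 0 ℕ.< s → (∀ j → s ℕ.≤ D ℕ.* ∣ R j ∣) →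
                  ∃ λ x → length T ℕ.≤ D ℕ.* hits x T
  popular-point D T s>0 dense = averaging (λ x → D ℕ.* hits x T) s>0
    (≤-trans (∑-hits-≥ D T dense) (≤-reflexive (*-distribˡ-sum D (λ x → hits x T))))

witnessedFromBound : ℕ → ℕ → ℕ
witnessedFromBound D zero    = 0
witnessedFromBound D (suc m) = suc (D ℕ.* witnessedFromBound D m)

witnessedBound : ℕ → ℕ → ℕ
witnessedBound D zero    = 0
witnessedBound D (suc m) = suc (witnessedFromBound D (witnessedBound D m))

-- Adm i j k ⊆ V_ik holds the values of γ_ik acceptable to j.  Outside i < j < k it is all of
-- V_ik, so density holds for every triple and constraints from out-of-order triples are vacuous.
module Selection {N : ℕ} (size : Fin N → Fin N → ℕ) (nonempty : ∀ {i k} → i < k → 0 ℕ.< size i k)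
  (Adm : (i j k : Fin N) → Subset (size i k))
  (Adm-full-left  : ∀ {i j k} → ¬ i < j → ∀ x → x ∈ Adm i j k)
  (Adm-full-right : ∀ {i j k} → ¬ j < k → ∀ x → x ∈ Adm i j k)
  (D : ℕ) .{{_ : NonZero D}} (Adm-dense : ∀ i j k → size i k ℕ.≤ D ℕ.* ∣ Adm i j k ∣) where

  Witness : Fin N → List (Fin N) → Fin N → Set
  Witness i S k = Σ (Fin (size i k)) λ x → All (λ j → x ∈ Adm i j k) S

  WitnessedFrom : Fin N → List (Fin N) → Set
  WitnessedFrom i S = All (Witness i S) S

  Witnessed : List (Fin N) → Set
  Witnessed L = ∀ {i k} → i ∈ₗ L → k ∈ₗ L → i < k → Witness i L k

  witness-anti-mono : ∀ {i S T k} → S ⊆ T → Witness i T k → Witness i S k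
  witness-anti-mono S⊆T = Product.map₂ (anti-mono S⊆T)

  witness-∷ : ∀ {i j S k} → (∀ x → x ∈ Adm i j k) → Witness i S k → Witness i (j ∷ S) k
  witness-∷ full (x , serves) = x , full x ∷ serves

  extract-witnessedFrom : ∀ m {i} (S : List (Fin N)) → AllPairs _>_ S → All (i <_) S →
    witnessedFromBound D m ℕ.≤ length S →
    ∃ λ S₀ → S₀ ⊆ S × AllPairs _>_ S₀ × m ℕ.≤ length S₀ × WitnessedFrom i S₀
  extract-witnessedFrom zero    S _ _ _ = [] , (λ ()) , [] , z≤n , []
  extract-witnessedFrom (suc m) {i} (k ∷ S) (S<k ∷ sorted) (i<k ∷ i<S) (s≤s len)
    with x , popular-x ← popular-point (λ j → Adm i j k) D S (nonempty i<k) (λ j → Adm-dense i j k)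
    with S₀ , S₀⊆ , sorted₀ , len₀ , witnessed₀
           ← extract-witnessedFrom m (filter (λ j → x ∈? Adm i j k) S) (AllPairs.filter⁺ _ sorted)
               (anti-mono (filter-⊆ _ S) i<S) (*-cancelˡ-≤ D (≤-trans len popular-x))
    = k ∷ S₀ , ∷⁺ʳ k S₀⊆S , S₀<k ∷ sorted₀ , s≤s len₀ ,
      witness-∷ (Adm-full-right (<-irrefl refl)) (x , anti-mono S₀⊆ (all-filter _ S)) ∷
      All.zipWith (λ (w , j<k) → witness-∷ (Adm-full-right (<-asym j<k)) w) (witnessed₀ , S₀<k)
    where
    S₀⊆S : S₀ ⊆ S
    S₀⊆S = filter-⊆ _ S ∘ S₀⊆
    S₀<k : All (_< k) S₀
    S₀<k = anti-mono S₀⊆S S<k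

  -- The fan around the smallest index a is extracted largest index first, so it is run on the
  -- reversed list of the indices above a.
  extract-witnessed : ∀ m (T : List (Fin N)) → AllPairs _<_ T → witnessedBound D m ℕ.≤ length T →
    ∃ λ L → L ⊆ T × AllPairs _<_ L × length L ≡ m × Witnessed L
  extract-witnessed zero    T _ _ = [] , (λ ()) , [] , refl , λ ()
  extract-witnessed (suc m) (a ∷ T) (a<T ∷ sorted) (s≤s len)
    with S , S⊆ , sortedS , lenS , witnessedS
           ← extract-witnessedFrom (witnessedBound D m) (reverse T) (AllPairs-reverse⁺ sorted)
               (anti-mono Any.reverse⁻ a<T) (subst (_ ℕ.≤_) (sym (length-reverse T)) len)
    with L , L⊆ , sortedL , lenL , witnessedL
           ← extract-witnessed m (reverse S) (AllPairs-reverse⁺ sortedS)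
               (subst (_ ℕ.≤_) (sym (length-reverse S)) lenS)
    = a ∷ L , ∷⁺ʳ a L⊆T , a<L ∷ sortedL , cong suc lenL , witnessed
    where
    L⊆S : L ⊆ S
    L⊆S = Any.reverse⁻ ∘ L⊆
    L⊆T : L ⊆ T
    L⊆T = Any.reverse⁻ ∘ S⊆ ∘ L⊆S
    a<L : All (a <_) L
    a<L = anti-mono L⊆T a<T
    witnessed : Witnessed (a ∷ L)
    witnessed (here refl) (here refl) a<a = ⊥-elim (<-irrefl refl a<a)
    witnessed (here refl) (there k∈L) _   =
      witness-∷ (Adm-full-left (<-irrefl refl)) (witness-anti-mono L⊆S (All.lookup witnessedS (L⊆S k∈L)))
    witnessed (there i∈L) (here refl) i<a = ⊥-elim (<-asym i<a (All.lookup a<L i∈L))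
    witnessed (there i∈L) (there k∈L) i<k =
      witness-∷ (Adm-full-left (<-asym (All.lookup a<L i∈L))) (witnessedL i∈L k∈L i<k)

∣⁅x⁆∪p∣ : ∀ {n} (x : Fin n) (p : Subset n) → x ∉ p → ∣ ⁅ x ⁆ ∪ p ∣ ≡ suc ∣ p ∣
∣⁅x⁆∪p∣ zero    (inside  ∷ p) x∉p = ⊥-elim (x∉p here)
∣⁅x⁆∪p∣ zero    (outside ∷ p) _   = cong suc (cong ∣_∣ (∪-identityˡ p))
∣⁅x⁆∪p∣ (suc x) (inside  ∷ p) x∉p = cong suc (∣⁅x⁆∪p∣ x p (drop-not-there x∉p))
∣⁅x⁆∪p∣ (suc x) (outside ∷ p) x∉p = ∣⁅x⁆∪p∣ x p (drop-not-there x∉p)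

∈-⋃⁅⁆⁻ : ∀ {n} {x : Fin n} xs → x ∈ ⋃ (map ⁅_⁆ xs) → x ∈ₗ xs
∈-⋃⁅⁆⁻ []       x∈⊥ = ⊥-elim (∉⊥ x∈⊥)
∈-⋃⁅⁆⁻ (y ∷ ys) x∈ with x∈p∪q⁻ ⁅ y ⁆ (⋃ (map ⁅_⁆ ys)) x∈
... | inj₁ x∈y  = here (x∈⁅y⁆⇒x≡y y x∈y)
... | inj₂ x∈ys = there (∈-⋃⁅⁆⁻ ys x∈ys)

∣⋃⁅⁆∣ : ∀ {n} {xs : List (Fin n)} → Unique xs → ∣ ⋃ (map ⁅_⁆ xs) ∣ ≡ length xs
∣⋃⁅⁆∣ {n} []                        = ∣⊥∣≡0 n
∣⋃⁅⁆∣ {xs = x ∷ xs} (x∉xs ∷ unique) =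
  trans (∣⁅x⁆∪p∣ x _ (λ x∈ → All.lookup x∉xs (∈-⋃⁅⁆⁻ xs x∈) refl)) (cong suc (∣⋃⁅⁆∣ unique))

Candidates : ∀ {N} → PartitionedHypergraph N → Set
Candidates {N} H = (i j k : Fin N) → i < j → j < k → Subset (PartitionedHypergraph.size H i k)

module _ {N} (H : PartitionedHypergraph N) (C : Candidates H) where
  open PartitionedHypergraph H

  admissible : (i j k : Fin N) → Subset (size i k)
  admissible i j k with i <? j | j <? k
  ... | yes ij | yes jk = C i j k ij jk
  ... | _      | _      = ⊤

  admissible-full-left : ∀ {i j k} → ¬ i < j → ∀ x → x ∈ admissible i j k
  admissible-full-left {i} {j} {k} i≮j x with i <? j | j <? k
  ... | yes ij | _ = ⊥-elim (i≮j ij)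
  ... | no _   | _ = ∈⊤

  admissible-full-right : ∀ {i j k} → ¬ j < k → ∀ x → x ∈ admissible i j k
  admissible-full-right {i} {j} {k} j≮k x with i <? j | j <? k
  ... | _     | yes jk = ⊥-elim (j≮k jk)
  ... | yes _ | no _   = ∈⊤
  ... | no _  | no _   = ∈⊤

  ∈-admissible⇒∈C : ∀ {i j k x} (ij : i < j) (jk : j < k) → x ∈ admissible i j k → x ∈ C i j k ij jk
  ∈-admissible⇒∈C {i} {j} {k} ij jk with i <? j | j <? k
  ... | yes ij′ | yes jk′ rewrite <-irrelevant ij ij′ | <-irrelevant jk jk′ = id
  ... | no i≮j  | _       = ⊥-elim (i≮j ij)
  ... | yes _   | no j≮k  = ⊥-elim (j≮k jk)

  admissible-dense : ∀ D .{{_ : NonZero D}} → (∀ i j k ij jk → size i k ℕ.≤ D ℕ.* ∣ C i j k ij jk ∣) →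
                     ∀ i j k → size i k ℕ.≤ D ℕ.* ∣ admissible i j k ∣
  admissible-dense D dense i j k with i <? j | j <? k
  ... | yes ij | yes jk = dense i j k ij jk
  ... | yes _  | no _   rewrite ∣⊤∣≡n (size i k) = m≤n*m (size i k) D
  ... | no _   | _      rewrite ∣⊤∣≡n (size i k) = m≤n*m (size i k) D

Selected : ∀ {N} (H : PartitionedHypergraph N) → Candidates H → ℕ → Set
Selected {N} H C n =
  Σ (InducedSub H n) λ S →
    Σ ((i k : Fin N) → i ∈ InducedSub.I S → k ∈ InducedSub.I S → i < k → V H i k) λ γ →
      (i j k : Fin N) (iI : i ∈ InducedSub.I S) (jI : j ∈ InducedSub.I S) (kI : k ∈ InducedSub.I S)
      (ij : i < j) (jk : j < k) (ik : i < k) →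
      γ i k iI kI ik ∈ C i j k ij jk

select : ∀ {N} D .{{_ : NonZero D}} n → witnessedBound D n ℕ.≤ N →
         (H : PartitionedHypergraph N) (C : Candidates H) →
         (∀ i j k ij jk → PartitionedHypergraph.size H i k ℕ.≤ D ℕ.* ∣ C i j k ij jk ∣) →
         Selected H C n
select {N} D n bound≤N H C dense =
  conclude (extract-witnessed n (allFin N) (AllPairs.tabulate⁺-< id)
             (subst (_ ℕ.≤_) (sym (length-tabulate id)) bound≤N))
  where
  open PartitionedHypergraph H using (size; nonempty)
  open Selection size (λ {i} {k} → nonempty i k) (admissible H C) (admissible-full-left H C)
                 (admissible-full-right H C) D (admissible-dense H C D dense)
  conclude : ∀ {T} → (∃ λ L → L ⊆ T × AllPairs _<_ L × length L ≡ n × Witnessed L) → Selected H C n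
  conclude (L , _ , sortedL , lenL , witnessedL) =
    record { I = I ; card = trans (∣⋃⁅⁆∣ (AllPairs.map <⇒≢ sortedL)) lenL } ,
    (λ i k iI kI ik → proj₁ (witness iI kI ik)) ,
    λ i j k iI jI kI ij jk ik →
      ∈-admissible⇒∈C H C ij jk (All.lookup (proj₂ (witness iI kI ik)) (∈-⋃⁅⁆⁻ L jI))
    where
    I : Subset N
    I = ⋃ (map ⁅_⁆ L)
    witness : ∀ {i k} → i ∈ I → k ∈ I → i < k → Witness i L k
    witness iI kI = witnessedL (∈-⋃⁅⁆⁻ L iI) (∈-⋃⁅⁆⁻ L kI)

δ*s≤c⇒s≤↧δ*c : ∀ δ {s c} → 0ℚ <ℚ δ → δ * ℕ→ℚ s ≤ ℕ→ℚ c → s ℕ.≤ ↧ₙ δ ℕ.* c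
δ*s≤c⇒s≤↧δ*c δ@(mkℚ +[1+ a ] d-1 _) {s} {c} _ δs≤c = begin
  s                  ≤⟨ m≤n*m s (suc a) ⟩
  suc a ℕ.* s        ≤⟨ ℤ.drop‿+≤+ (subst₂ ℤ._≤_ numerators denominators (ℚᵘ.drop-*≤* cross)) ⟩
  c ℕ.* suc d-1      ≡⟨ *-comm c (suc d-1) ⟩
  suc d-1 ℕ.* c      ∎
  where
  open ≤-Reasoning
  cross : toℚᵘ δ ℚᵘ.* ℚᵘ.mkℚᵘ (+ s) 0 ℚᵘ.≤ ℚᵘ.mkℚᵘ (+ c) 0
  cross = ℚᵘ.≤-respʳ-≃ (toℚᵘ-fromℚᵘ _)
    (ℚᵘ.≤-respˡ-≃ (ℚᵘ.≃-trans (toℚᵘ-homo-* δ (ℕ→ℚ s)) (ℚᵘ.*-congˡ {toℚᵘ δ} (toℚᵘ-fromℚᵘ _)))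
      (toℚᵘ-mono-≤ δs≤c))
  numerators : (+[1+ a ] ℤ.* + s) ℤ.* + 1 ≡ + (suc a ℕ.* s)
  numerators = trans (ℤ.*-identityʳ _) (sym (ℤ.pos-* (suc a) s))
  denominators : + c ℤ.* + (suc d-1 ℕ.* 1) ≡ + (c ℕ.* suc d-1)
  denominators = trans (sym (ℤ.pos-* c _)) (cong (λ d → + (c ℕ.* d)) (*-identityʳ (suc d-1)))
δ*s≤c⇒s≤↧δ*c (mkℚ +0       _ _) δ>0 with () ← positive δ>0
δ*s≤c⇒s≤↧δ*c (mkℚ -[1+ _ ] _ _) δ>0 with () ← positive δ>0

lemma9 : (δ : ℚ) → 0ℚ <ℚ δ → (n : ℕ) →
    ∃ λ (N : ℕ) →
      (H : PartitionedHypergraph N) →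
      (C : (i j k : Fin N) → i < j → j < k → Subset (PartitionedHypergraph.size H i k)) →
      ((i j k : Fin N) (ij : i < j) (jk : j < k) →
        δ * ℕ→ℚ (PartitionedHypergraph.size H i k) ≤ ℕ→ℚ ∣ C i j k ij jk ∣) →
      Σ (InducedSub H n) λ S →
        Σ ((i k : Fin N) → i ∈ InducedSub.I S → k ∈ InducedSub.I S → i < k → V H i k) λ γ →
          (i j k : Fin N) (iI : i ∈ InducedSub.I S) (jI : j ∈ InducedSub.I S) (kI : k ∈ InducedSub.I S)
          (ij : i < j) (jk : j < k) (ik : i < k) →
          γ i k iI kI ik ∈ C i j k ij jk
lemma9 δ δ>0 n = witnessedBound (↧ₙ δ) n , λ H C dense →
  select (↧ₙ δ) n ≤-refl H C (λ i j k ij jk → δ*s≤c⇒s≤↧δ*c δ δ>0 (dense i j k ij jk))
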